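{- Let $1\le r<n/2$ and let $\mathcal{F}\subseteq\binom{[n]}{r}$ be shifted and intersecting. For $F\in\mathcal{F}$ let $\kappa_F$ be the largest nonnegative integer $\kappa$ with $2\kappa\le n$ and $|F\cap[2\kappa]|=\kappa$, and define $\phi(F)=F$ if $1\in F$ and $\phi(F)=F\,\triangle\,[2\kappa_F]$ if $1\notin F$. If $\{\phi(F):F\in\mathcal{F}\}=\binom{[n]}{r}_1$, then $\mathcal{F}=\binom{[n]}{r}_1$.
   Context: $[m]=\{1,\dots,m\}$ (with $[0]=\emptyset$), $\binom{X}{r}$ is the family of $r$-element subsets of $X$, $\binom{[n]}{r}_1=\{F\in\binom{[n]}{r}:1\in F\}$, and $\triangle$ is symmetric difference. A family is intersecting if any two of its members intersect. For $i,j\in[n]$ and $A\subseteq[n]$, $\sigma_{i,j}(A)=(A\setminus\{i\})\cup\{j\}$ if $i\in A$, $j\notin A$, and $\sigma_{i,j}(A)=A$ otherwise; for a family $\mathcal{F}$, $\sigma_{i,j}(\mathcal{F})=\{\sigma'_{i,j}(A):A\in\mathcal{F}\}$ where $\sigma'_{i,j}(A)=\sigma_{i,j}(A)$ if $\sigma_{i,j}(A)\notin\mathcal{F}$ and $\sigma'_{i,j}(A)=A$ otherwise. $\mathcal{F}\subseteq\binom{[n]}{r}$ is shifted if $\sigma_{i,j}(\mathcal{F})=\mathcal{F}$ for all $1\le j<i\le n$. -}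

module Defs where

open import Data.Bool using (Bool; true; false; not; _∧_; _xor_; if_then_else_)
open import Data.Nat using (ℕ; zero; suc; _*_; _≤_; _<ᵇ_; _≤ᵇ_; _≡ᵇ_)
open import Data.Fin using (Fin; toℕ)
open import Data.Vec using (Vec; []; _∷_; lookup; tabulate; zipWith; _[_]≔_)
open import Data.Fin.Subset using (Subset; _∩_; ∣_∣; Nonempty)
open import Data.Product using (Σ; ∃; _×_)
open import Function.Bundles using (_⇔_)
open import Relation.Binary.PropositionalEquality using (_≡_)

-- Convention: a subset of [n] = {1,…,n} is a 'Subset n' (Vec Bool n);
-- the element k ∈ [n] corresponds to the index k-1 : Fin n.
Family : ℕ → Set
Family n = Subset n → Bool

_∈ᶠ_ : ∀ {n} → Subset n → Family n → Set
A ∈ᶠ 𝓕 = 𝓕 A ≡ true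

oneIn : ∀ {n} → Subset n → Bool
oneIn []      = false
oneIn (b ∷ _) = b

-- [m] ∩ [n] as a subset of [n]: indices k-1 with k ≤ m
prefix : ∀ {n} → ℕ → Subset n
prefix m = tabulate (λ i → toℕ i <ᵇ m)

_△_ : ∀ {n} → Subset n → Subset n → Subset n
_△_ = zipWith _xor_

σ : ∀ {n} → Fin n → Fin n → Subset n → Subset n
σ i j A = if lookup A i ∧ not (lookup A j) then (A [ i ]≔ false) [ j ]≔ true else A

σ' : ∀ {n} → Family n → Fin n → Fin n → Subset n → Subset n
σ' 𝓕 i j A = if 𝓕 (σ i j A) then A else σ i j A

_∈σ[_,_]_ : ∀ {n} → Subset n → Fin n → Fin n → Family n → Set
B ∈σ[ i , j ] 𝓕 = ∃ λ A → A ∈ᶠ 𝓕 × σ' 𝓕 i j A ≡ B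

Uniform : ∀ {n} → ℕ → Family n → Set
Uniform r 𝓕 = ∀ A → A ∈ᶠ 𝓕 → ∣ A ∣ ≡ r

Shifted : ∀ {n} → Family n → Set
Shifted 𝓕 = ∀ i j → toℕ j Data.Nat.< toℕ i → ∀ B → (B ∈σ[ i , j ] 𝓕 ⇔ B ∈ᶠ 𝓕)

Intersecting : ∀ {n} → Family n → Set
Intersecting 𝓕 = ∀ A B → A ∈ᶠ 𝓕 → B ∈ᶠ 𝓕 → Nonempty (A ∩ B)

goodκ : ∀ {n} → Subset n → ℕ → Bool
goodκ {n} F κ = (2 * κ ≤ᵇ n) ∧ (∣ F ∩ prefix (2 * κ) ∣ ≡ᵇ κ)

-- largest admissible κ ≤ k (0 is always admissible)
largestGood : ∀ {n} → Subset n → ℕ → ℕ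
largestGood F zero    = zero
largestGood F (suc k) = if goodκ F (suc k) then suc k else largestGood F k

-- κ_F: largest κ with 2κ ≤ n and |F ∩ [2κ]| = κ (any such κ is ≤ n)
κ : ∀ {n} → Subset n → ℕ
κ {n} F = largestGood F n

φ : ∀ {n} → Subset n → Subset n
φ F = if oneIn F then F else F △ prefix (2 * κ F)

InStar : ∀ {n} → ℕ → Subset n → Set
InStar r B = ∣ B ∣ ≡ r × oneIn B ≡ true

_∈φ[_] : ∀ {n} → Subset n → Family n → Set
B ∈φ[ 𝓕 ] = ∃ λ A → A ∈ᶠ 𝓕 × φ A ≡ B

module Submission where

-- Write n = 1 + k + (r - 1) with k > r and M = {2, …, k + 1}. The set ∁ M = {1} ∪ {k + 2, …, n}
-- is in the star, so ∁ M = φ(A) for some A ∈ 𝓕. If 1 ∉ A then A = ∁ M △ [2κ]; as |A| = r < |M|,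
-- some point of M lies outside A, hence outside [2κ], so A ∩ [2κ] = [2κ] ∖ {1} and |A ∩ [2κ]| = κ
-- forces κ = 1: shifting 2 to 1 in A puts ∁ M in 𝓕. A member F avoiding 1 meets ∁ M; moving such
-- a point into M ∖ F (nonempty, as |F| = r < |M|) gives a member avoiding 1 with fewer points in
-- ∁ M, so by descent every member contains 1. Then φ fixes 𝓕 pointwise and 𝓕 is its φ-image.

open import Defs
open import Data.Nat using (ℕ; zero; suc; _+_; _*_; _∸_; _≤_; _<_; z≤n; s≤s; s≤s⁻¹; z<s; _<ᵇ_; pred)
open import Data.Nat.Properties
  using (<⇒<ᵇ; <ᵇ⇒<; ≤ᵇ⇒≤; ≡ᵇ⇒≡; <⇒≱; ≮⇒≥; <-≤-trans; ≤-<-trans; <-trans; ≤-trans; n<1+n;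
         +-identityʳ; +-suc; +-comm;
         +-cancelˡ-≤; m+n≤o⇒m≤o∸n; m∸n+n≡m; m+n∸m≡n; <⇒≤; m≤m+n)
open import Data.Bool using (true; false; not; _xor_)
open import Data.Bool.Properties using (T-≡; T-∧; ¬-not; xor-identityʳ; xor-assoc; xor-same)
open import Data.Fin using (Fin; zero; suc; toℕ; _≟_)
open import Data.Fin.Properties using (¬∀⟶∃¬)
open import Data.Vec using ([]; _∷_; lookup; _[_]≔_; here; there)
open import Data.Vec.Properties
  using (lookup-zipWith; lookup-map; lookup∘tabulate; lookup∘update; lookup∘update′;
         []=⇒lookup; lookup⇒[]=; ∷-injectiveˡ; ∷-injectiveʳ)
open import Data.Fin.Subset using (Subset; inside; outside; _∈_; _∉_; _⊆_; _⊈_; _∩_; ∁; _-_; ∣_∣)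
open import Data.Fin.Subset.Properties
  using (_∈?_; p⊆q⇒∣p∣≤∣q∣; x∈p∩q⁺; x∈p∩q⁻; x∈p⇒x∉∁p; x∈∁p⇒x∉p; x∈p∧x≢y⇒x∈p-y; x∈p⇒∣p-x∣<∣p∣;
         ∣∁p∣≡n∸∣p∣; out⊆)
open import Data.Product using (∃; _×_; _,_; proj₁; proj₂)
open import Data.Sum using (_⊎_; inj₁; inj₂; map₂)
open import Data.Empty using (⊥; ⊥-elim)
open import Function.Bundles using (_⇔_; mk⇔; Equivalence)
open import Relation.Nullary using (yes; no; contradiction)
open import Relation.Nullary.Decidable using (_→-dec_)
open import Relation.Binary.PropositionalEquality
  using (_≡_; _≢_; refl; sym; trans; cong; cong₂; subst; subst₂; module ≡-Reasoning)

module _ {n : ℕ} where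

  ⊈⇒∃∉ : {p q : Subset n} → p ⊈ q → ∃ λ i → i ∈ p × i ∉ q
  ⊈⇒∃∉ {p} {q} p⊈q with ¬∀⟶∃¬ n (λ i → i ∈ p → i ∈ q) (λ i → i ∈? p →-dec i ∈? q) (λ p⊆q → p⊈q (p⊆q _))
  ... | i , i∈p⇏i∈q with i ∈? p
  ...   | yes i∈p = i , i∈p , λ i∈q → i∈p⇏i∈q (λ _ → i∈q)
  ...   | no  i∉p = ⊥-elim (i∈p⇏i∈q (λ i∈p → contradiction i∈p i∉p))

  ∣p∣<∣q∣⇒q⊈p : {p q : Subset n} → ∣ p ∣ < ∣ q ∣ → q ⊈ p
  ∣p∣<∣q∣⇒q⊈p ∣p∣<∣q∣ q⊆p = <⇒≱ ∣p∣<∣q∣ (p⊆q⇒∣p∣≤∣q∣ q⊆p)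

  ∉⇒lookup≡false : {i : Fin n} {p : Subset n} → i ∉ p → lookup p i ≡ false
  ∉⇒lookup≡false {i} {p} i∉p = ¬-not (λ lookup≡true → i∉p (lookup⇒[]= i p lookup≡true))

  lookup-△ : (p q : Subset n) (i : Fin n) → lookup (p △ q) i ≡ lookup p i xor lookup q i
  lookup-△ p q i = lookup-zipWith _xor_ i p q

  lookup-∁ : (p : Subset n) (i : Fin n) → lookup (∁ p) i ≡ not (lookup p i)
  lookup-∁ p i = lookup-map i not p

  lookup-prefix : (c : ℕ) (i : Fin n) → lookup (prefix c) i ≡ (toℕ i <ᵇ c)
  lookup-prefix c = lookup∘tabulate _

  ∈prefix⁺ : {c : ℕ} {i : Fin n} → toℕ i < c → i ∈ prefix c
  ∈prefix⁺ {c} {i} i<c =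
    lookup⇒[]= i (prefix c) (trans (lookup-prefix c i) (Equivalence.to T-≡ (<⇒<ᵇ i<c)))

  ∈prefix⁻ : {c : ℕ} {i : Fin n} → i ∈ prefix c → toℕ i < c
  ∈prefix⁻ {c} {i} i∈ =
    <ᵇ⇒< (toℕ i) c (Equivalence.from T-≡ (trans (sym (lookup-prefix c i)) ([]=⇒lookup i∈)))

  prefix<∁prefix : {c : ℕ} {i j : Fin n} → i ∈ prefix c → j ∉ prefix c → toℕ i < toℕ j
  prefix<∁prefix {c} i∈ j∉ = <-≤-trans (∈prefix⁻ i∈) (≮⇒≥ (λ j<c → j∉ (∈prefix⁺ {c} j<c)))

∣prefix∣ : ∀ {n} c → c ≤ n → ∣ prefix {n} c ∣ ≡ c
∣prefix∣ {zero}  zero    _   = refl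
∣prefix∣ {suc n} zero    _   = ∣prefix∣ {n} zero z≤n
∣prefix∣ {suc n} (suc c) c≤n = cong suc (∣prefix∣ c (s≤s⁻¹ c≤n))

△prefix0 : ∀ {n} (p : Subset n) → p △ prefix 0 ≡ p
△prefix0 []      = refl
△prefix0 (b ∷ p) = cong₂ _∷_ (xor-identityʳ b) (△prefix0 p)

σ-closed : ∀ {n} {𝓕 : Family n} → Shifted 𝓕 →
           ∀ {i j} → toℕ j < toℕ i → ∀ {A} → A ∈ᶠ 𝓕 → σ i j A ∈ᶠ 𝓕
σ-closed {𝓕 = 𝓕} shifted {i} {j} j<i {A} A∈𝓕
  with 𝓕 (σ i j A) in σA∉𝓕 | Equivalence.to (shifted i j j<i (σ' 𝓕 i j A)) (A , A∈𝓕 , refl)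
... | true  | _       = refl
... | false | σ'A∈𝓕 = trans (sym σA∉𝓕) σ'A∈𝓕

module _ {n : ℕ} {A : Subset n} {i j : Fin n} (i∈A : i ∈ A) (j∉A : j ∉ A) where

  σ-move : σ i j A ≡ (A [ i ]≔ outside) [ j ]≔ inside
  σ-move rewrite []=⇒lookup i∈A | ∉⇒lookup≡false j∉A = refl

  lookup-σ : ∀ {x} → x ≢ j → lookup (σ i j A) x ≡ lookup (A [ i ]≔ outside) x
  lookup-σ {x} x≢j =
    trans (cong (λ B → lookup B x) σ-move) (lookup∘update′ x≢j (A [ i ]≔ outside) inside)

  ∈σ⁻ : ∀ {x} → x ∈ σ i j A → x ≡ j ⊎ (x ≢ i × x ∈ A)
  ∈σ⁻ {x} x∈σ with x ≟ j | x ≟ i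
  ... | yes x≡j | _        = inj₁ x≡j
  ... | no  x≢j | yes refl = contradiction (trans (sym (lookup∘update x A outside)) lookup-x) λ ()
    where
    lookup-x : lookup (A [ x ]≔ outside) x ≡ inside
    lookup-x = trans (sym (lookup-σ x≢j)) ([]=⇒lookup x∈σ)
  ... | no  x≢j | no  x≢i  = inj₂ (x≢i , lookup⇒[]= x A lookup-x)
    where
    lookup-x : lookup A x ≡ inside
    lookup-x = begin
      lookup A x                   ≡⟨ lookup∘update′ x≢i A outside ⟨
      lookup (A [ i ]≔ outside) x  ≡⟨ lookup-σ x≢j ⟨
      lookup (σ i j A) x           ≡⟨ []=⇒lookup x∈σ ⟩
      inside                       ∎
      where open ≡-Reasoning

module _ {n r : ℕ} {𝓕 : Family n} (uniform : Uniform r 𝓕) (shifted : Shifted 𝓕)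
         (intersecting : Intersecting 𝓕) {x : Fin n} {M : Subset n} (x∉M : x ∉ M) (r<∣M∣ : r < ∣ M ∣)
         (M<∁M : ∀ {p q} → p ∈ ∁ M → p ≢ x → q ∈ M → toℕ q < toℕ p) (∁M∈𝓕 : ∁ M ∈ᶠ 𝓕) where

  private
    no-avoider : ∀ m F → ∣ F ∩ ∁ M ∣ < m → F ∈ᶠ 𝓕 → x ∉ F → ⊥
    no-avoider (suc m) F bound F∈𝓕 x∉F
      with intersecting F (∁ M) F∈𝓕 ∁M∈𝓕
         | ⊈⇒∃∉ (∣p∣<∣q∣⇒q⊈p (subst (_< ∣ M ∣) (sym (uniform F F∈𝓕)) r<∣M∣))
    ... | p , p∈F∩∁M | q , q∈M , q∉F =
      no-avoider m (σ p q F) (≤-trans shrinks (s≤s⁻¹ bound)) (σ-closed shifted q<p F∈𝓕) x∉σF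
      where
      p∈F : p ∈ F
      p∈F = proj₁ (x∈p∩q⁻ F (∁ M) p∈F∩∁M)

      q<p : toℕ q < toℕ p
      q<p = M<∁M (proj₂ (x∈p∩q⁻ F (∁ M) p∈F∩∁M)) (λ { refl → x∉F p∈F }) q∈M

      x∉σF : x ∉ σ p q F
      x∉σF x∈σF with ∈σ⁻ p∈F q∉F x∈σF
      ... | inj₁ refl        = x∉M q∈M
      ... | inj₂ (_ , x∈F)  = x∉F x∈F

      σF∩∁M⊆ : σ p q F ∩ ∁ M ⊆ (F ∩ ∁ M) - p
      σF∩∁M⊆ {y} y∈ with x∈p∩q⁻ (σ p q F) (∁ M) y∈
      ... | y∈σF , y∈∁M with ∈σ⁻ p∈F q∉F y∈σF
      ...   | inj₁ refl           = contradiction y∈∁M (x∈p⇒x∉∁p q∈M)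
      ...   | inj₂ (y≢p , y∈F)    = x∈p∧x≢y⇒x∈p-y (x∈p∩q⁺ (y∈F , y∈∁M)) y≢p

      shrinks : ∣ σ p q F ∩ ∁ M ∣ < ∣ F ∩ ∁ M ∣
      shrinks = ≤-<-trans (p⊆q⇒∣p∣≤∣q∣ σF∩∁M⊆) (x∈p⇒∣p-x∣<∣p∣ p∈F∩∁M)

  ∈-all-members : ∀ {F} → F ∈ᶠ 𝓕 → x ∈ F
  ∈-all-members {F} F∈𝓕 with x ∈? F
  ... | yes x∈F = x∈F
  ... | no  x∉F = ⊥-elim (no-avoider _ F (n<1+n _) F∈𝓕 x∉F)

Admissible : ∀ {n} → Subset n → ℕ → Set
Admissible {n} F m = 2 * m ≤ n × ∣ F ∩ prefix (2 * m) ∣ ≡ m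

goodκ-sound : ∀ {n} {F : Subset n} {m} → goodκ F m ≡ true → Admissible F m
goodκ-sound {n} {F} {m} good with Equivalence.to T-∧ (Equivalence.from T-≡ good)
... | 2m≤n , count≡m = ≤ᵇ⇒≤ (2 * m) n 2m≤n , ≡ᵇ⇒≡ ∣ F ∩ prefix (2 * m) ∣ m count≡m

largestGood-sound : ∀ {n} (F : Subset n) k → largestGood F k ≡ 0 ⊎ goodκ F (largestGood F k) ≡ true
largestGood-sound F zero = inj₁ refl
largestGood-sound F (suc k) with goodκ F (suc k) in good
... | true  = inj₂ good
... | false = largestGood-sound F k

κ-admissible : ∀ {n} (F : Subset n) → κ F ≡ 0 ⊎ Admissible F (κ F)
κ-admissible {n} F = map₂ (goodκ-sound {F = F}) (largestGood-sound F n)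

xor-solveˡ : ∀ {x y z} → x xor y ≡ z → x ≡ z xor y
xor-solveˡ {x} {y} {z} eq = begin
  x                ≡⟨ xor-identityʳ x ⟨
  x xor false      ≡⟨ cong (x xor_) (xor-same y) ⟨
  x xor (y xor y)  ≡⟨ xor-assoc x y y ⟨
  (x xor y) xor y  ≡⟨ cong (_xor y) eq ⟩
  z xor y          ∎
  where open ≡-Reasoning

module _ {n : ℕ} {A : Subset n} (c k : ℕ) (A△c≡∁k : A △ prefix c ≡ ∁ (prefix k)) where

  prefix∩prefix⊆ : ∀ {i} → i ∈ prefix k → i ∈ prefix c → i ∈ A
  prefix∩prefix⊆ {i} i∈k i∈c = lookup⇒[]= i A (begin
    lookup A i                                         ≡⟨ xor-solveˡ pointwise ⟩
    not (lookup (prefix k) i) xor lookup (prefix c) i  ≡⟨ cong₂ (λ a b → not a xor b) k[i] c[i] ⟩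
    inside                                             ∎)
    where
    open ≡-Reasoning
    k[i] : lookup (prefix k) i ≡ true
    k[i] = []=⇒lookup i∈k
    c[i] : lookup (prefix c) i ≡ true
    c[i] = []=⇒lookup i∈c
    pointwise : lookup A i xor lookup (prefix c) i ≡ not (lookup (prefix k) i)
    pointwise = trans (sym (lookup-△ A (prefix c) i))
                      (trans (cong (λ B → lookup B i) A△c≡∁k) (lookup-∁ (prefix k) i))

  prefix-⊆ : prefix k ⊈ A → prefix c ⊆ A
  prefix-⊆ k⊈A {i} i∈c with ⊈⇒∃∉ k⊈A
  ... | q , q∈k , q∉A =
    prefix∩prefix⊆ (∈prefix⁺ {c = k} (<-trans (prefix<∁prefix {c = c} i∈c q∉c) (∈prefix⁻ q∈k))) i∈c
    where
    q∉c : q ∉ prefix c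
    q∉c q∈c = q∉A (prefix∩prefix⊆ q∈k q∈c)

prefix⊆⇒≤∣∩prefix∣ : ∀ {n} {A : Subset n} {c} → c ≤ n → prefix c ⊆ A → c ≤ ∣ A ∩ prefix c ∣
prefix⊆⇒≤∣∩prefix∣ {A = A} {c} c≤n c⊆A =
  subst (_≤ ∣ A ∩ prefix c ∣) (∣prefix∣ c c≤n) (p⊆q⇒∣p∣≤∣q∣ (λ i∈c → x∈p∩q⁺ (c⊆A i∈c , i∈c)))

2*m≤1+m⇒m≤1 : ∀ m → 2 * m ≤ suc m → m ≤ 1
2*m≤1+m⇒m≤1 m 2m≤1+m = +-cancelˡ-≤ m m 1 (subst₂ _≤_ (cong (m +_) (+-identityʳ m)) (+-comm 1 m) 2m≤1+m)

-- middle k = {2, …, k + 1}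
middle : ∀ {n} → ℕ → Subset (suc n)
middle k = outside ∷ prefix k

σ₁₀-∁middle : ∀ {n} k (A : Subset (suc n)) → zero ∈ A → A △ prefix 1 ≡ ∁ (prefix k) →
              σ (suc zero) zero (outside ∷ A) ≡ ∁ (middle k)
σ₁₀-∁middle zero    (inside ∷ A) here A△1≡∁k = contradiction (∷-injectiveˡ A△1≡∁k) λ ()
σ₁₀-∁middle (suc k) (inside ∷ A) here A△1≡∁k =
  cong (λ B → inside ∷ outside ∷ B) (trans (sym (△prefix0 A)) (∷-injectiveʳ A△1≡∁k))

admissible⇒≤1 : ∀ {n} {A : Subset (suc n)} k m → prefix k ⊈ A → Admissible (outside ∷ A) (suc m) →
                A △ prefix (pred (2 * suc m)) ≡ ∁ (prefix k) → suc m ≤ 1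
admissible⇒≤1 {A = A} k m k⊈A (2m≤n , count≡m) A△c≡∁k = 2*m≤1+m⇒m≤1 (suc m) (s≤s (subst (_ ≤_) count≡m c≤count))
  where
  c≤count : pred (2 * suc m) ≤ ∣ A ∩ prefix (pred (2 * suc m)) ∣
  c≤count = prefix⊆⇒≤∣∩prefix∣ (s≤s⁻¹ 2m≤n) (prefix-⊆ (pred (2 * suc m)) k A△c≡∁k k⊈A)

φ≡∁middle⇒ : ∀ {n} k (A : Subset (suc (suc n))) → middle k ⊈ A → φ A ≡ ∁ (middle k) →
             A ≡ ∁ (middle k) ⊎ σ (suc zero) zero A ≡ ∁ (middle k)
φ≡∁middle⇒ k (inside  ∷ A) _   φA≡∁M = inj₁ φA≡∁M
φ≡∁middle⇒ k (outside ∷ A) M⊈A φA≡∁M = inj₂ (σ₁₀≡∁middle (κ-admissible (outside ∷ A)) φA≡∁M)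
  where
  k⊈A : prefix k ⊈ A
  k⊈A k⊆A = M⊈A (out⊆ k⊆A)

  σ₁₀≡∁middle : ∀ {m} → m ≡ 0 ⊎ Admissible (outside ∷ A) m → (outside ∷ A) △ prefix (2 * m) ≡ ∁ (middle k) →
                σ (suc zero) zero (outside ∷ A) ≡ ∁ (middle k)
  σ₁₀≡∁middle {zero}  _          A△≡∁M = contradiction (∷-injectiveˡ A△≡∁M) λ ()
  σ₁₀≡∁middle {suc m} (inj₂ adm) A△≡∁M with admissible⇒≤1 k m k⊈A adm (∷-injectiveʳ A△≡∁M)
  ... | s≤s z≤n = σ₁₀-∁middle k A (prefix-⊆ 1 k (∷-injectiveʳ A△≡∁M) k⊈A here) (∷-injectiveʳ A△≡∁M)

φ-fix : ∀ {n} {A : Subset (suc n)} → zero ∈ A → φ A ≡ A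
φ-fix here = refl

oneIn-∈ : ∀ {n} {A : Subset (suc n)} → zero ∈ A → oneIn A ≡ true
oneIn-∈ here = refl

split-length : ∀ {n t} → 2 * suc t < n → ∃ λ k → suc t < k × n ≡ suc (k + t)
split-length {n} {t} 2r<n = n ∸ suc t , r<n∸r , sym n∸r+t+1≡n
  where
  r+r<n : suc (suc t) + suc t ≤ n
  r+r<n = subst (λ x → suc (suc t + x) ≤ n) (+-identityʳ (suc t)) 2r<n

  r<n∸r : suc t < n ∸ suc t
  r<n∸r = m+n≤o⇒m≤o∸n (suc (suc t)) r+r<n

  n∸r+t+1≡n : suc (n ∸ suc t + t) ≡ n
  n∸r+t+1≡n = trans (sym (+-suc (n ∸ suc t) t)) (m∸n+n≡m r≤n)
    where
    r≤n : suc t ≤ n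
    r≤n = <⇒≤ (≤-trans (m≤m+n (suc (suc t)) (suc t)) r+r<n)

∣∁middle∣ : ∀ k t → ∣ ∁ (middle {k + t} k) ∣ ≡ suc t
∣∁middle∣ k t = cong suc (begin
  ∣ ∁ (prefix {k + t} k) ∣      ≡⟨ ∣∁p∣≡n∸∣p∣ (prefix {k + t} k) ⟩
  k + t ∸ ∣ prefix {k + t} k ∣  ≡⟨ cong (k + t ∸_) (∣prefix∣ {k + t} k (m≤m+n k t)) ⟩
  k + t ∸ k                     ≡⟨ m+n∸m≡n k t ⟩
  t                             ∎)
  where open ≡-Reasoning

middle<∁middle : ∀ {n k} {p q : Fin (suc n)} → p ∈ ∁ (middle k) → p ≢ zero → q ∈ middle k → toℕ q < toℕ p
middle<∁middle {p = zero}                 _            p≢0 _            = contradiction refl p≢0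
middle<∁middle {k = k} {suc p} {suc q} (there p∈∁M) _   (there q∈M) =
  s≤s (prefix<∁prefix {c = k} q∈M (x∈∁p⇒x∉p p∈∁M))

∁middle∈ : ∀ {n r k} {𝓕 : Family (suc (suc n))} → Uniform r 𝓕 → Shifted 𝓕 → r < ∣ middle {suc n} k ∣ →
           ∁ (middle k) ∈φ[ 𝓕 ] → ∁ (middle k) ∈ᶠ 𝓕
∁middle∈ {n} {k = k} {𝓕} uniform shifted r<∣M∣ (A , A∈𝓕 , φA≡∁M)
  with φ≡∁middle⇒ k A (∣p∣<∣q∣⇒q⊈p (subst (_< ∣ middle {suc n} k ∣) (sym (uniform A A∈𝓕)) r<∣M∣)) φA≡∁M
... | inj₁ A≡∁M  = subst (_∈ᶠ 𝓕) A≡∁M A∈𝓕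
... | inj₂ σA≡∁M = subst (_∈ᶠ 𝓕) σA≡∁M (σ-closed shifted z<s A∈𝓕)

lemma10 : (n r : ℕ) → 1 ≤ r → 2 * r < n → (𝓕 : Family n) →
          Uniform r 𝓕 → Shifted 𝓕 → Intersecting 𝓕 →
          (∀ B → (B ∈φ[ 𝓕 ] ⇔ InStar r B)) →
          ∀ B → (B ∈ᶠ 𝓕 ⇔ InStar r B)
lemma10 n (suc t) _ 2r<n 𝓕 uniform shifted intersecting φ[𝓕]≡star with split-length 2r<n
... | zero  , () , _
... | suc k , r<k , refl = λ B → mk⇔ (λ B∈𝓕 → uniform B B∈𝓕 , oneIn-∈ (1∈ B∈𝓕)) (star⊆𝓕 B)
  where
  r<∣M∣ : suc t < ∣ middle {suc k + t} (suc k) ∣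
  r<∣M∣ = subst (suc t <_) (sym (∣prefix∣ (suc k) (s≤s (m≤m+n k t)))) r<k

  ∁M∈𝓕 : ∁ (middle (suc k)) ∈ᶠ 𝓕
  ∁M∈𝓕 = ∁middle∈ {k = suc k} uniform shifted r<∣M∣
           (Equivalence.from (φ[𝓕]≡star _) (∣∁middle∣ (suc k) t , refl))

  1∈ : ∀ {F} → F ∈ᶠ 𝓕 → zero ∈ F
  1∈ = ∈-all-members uniform shifted intersecting (λ ()) r<∣M∣ (middle<∁middle {k = suc k}) ∁M∈𝓕

  star⊆𝓕 : ∀ B → InStar (suc t) B → B ∈ᶠ 𝓕
  star⊆𝓕 B B∈star with Equivalence.from (φ[𝓕]≡star B) B∈star
  ... | A , A∈𝓕 , φA≡B = subst (_∈ᶠ 𝓕) (trans (sym (φ-fix (1∈ A∈𝓕))) φA≡B) A∈𝓕
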